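{- For all $M,N\in\Lambda$: $\langle [\ ], M^\bullet\rangle \rightsquigarrow^* \underline{N}$ if and only if $M\rightarrow^* N$ (multi-step $\beta$-reduction) and $N\in\mathrm{NF}$.
   Context: $\Lambda$ is the set of untyped $\lambda$-terms, $\mathrm{NF}$ the set of $\lambda$-terms in $\beta$-normal form, and $\rightarrow^*$ on $\Lambda$ is the reflexive-transitive closure of one-step $\beta$-reduction. A context $C[\ ]$ is a $\lambda$-term with exactly one hole $[\ ]$; $[\ ]$ alone is the trivial context; $C[M]$ is the result of placing $M$ in the hole (variables may be captured). For every $\lambda$-term $M$ there is a new constant symbol $\underline{M}$, called an atom; atoms have no free variables and substitution leaves an atom unchanged. Terms may be built from variables, atoms, application and abstraction, with substitution and free variables extended accordingly. For $M\in\Lambda$, $M^\bullet$ is the result of replacing each free variable $x$ of $M$ in $M$ by $\underline{x}$; $\Lambda^\bullet=\{M^\bullet\mid M\in\Lambda\}$. Write $M\ \vec N$ for $M\ N_1\cdots N_n$ with $n\ge 0$. $\Lambda^{\mathrm{rb}}$ is the smallest set such that: $\underline{M}\in\Lambda^{\mathrm{rb}}$ for every $M\in\Lambda$; $\langle C[\ ], M\rangle \in \Lambda^{\mathrm{rb}}$ for every context $C[\ ]$ and $M\in\Lambda^\bullet$; $\langle C[\ ], M\ \vec N\rangle\in\Lambda^{\mathrm{rb}}$ for every context $C[\ ]$, $M\in\Lambda^{\mathrm{rb}}$ and $\vec N\in\Lambda^\bullet$ (formal application). The reduction $\rightsquigarrow$ on $\Lambda^{\mathrm{rb}}$ is the smallest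 relation with: (1) $\langle C[\ ], \underline{M}\rangle \rightsquigarrow \underline{C[M]}$ for $M\in\Lambda$; (2) $\langle C[\ ], \lambda x.M\rangle \rightsquigarrow \langle C[\lambda x.[\ ]], M[x:=\underline{x}]\rangle$ for $\lambda x.M\in\Lambda^\bullet$; (3) $\langle C[\ ], \underline{M}\ N_0\ \vec N\rangle \rightsquigarrow \langle C[\ ], \langle M\ [\ ], N_0\rangle\ \vec N\rangle$ for $M\in\Lambda$, $N_0,\vec N\in\Lambda^\bullet$; (4) $\langle C[\ ], (\lambda x.M)\ N_0\ \vec N\rangle\rightsquigarrow\langle C[\ ], M[x:=N_0]\ \vec N\rangle$ for $\lambda x.M, N_0,\vec N\in\Lambda^\bullet$; (5) if $M,M'\in\Lambda^{\mathrm{rb}}$, $M\rightsquigarrow M'$ and $\vec N\in\Lambda^\bullet$, then $\langle C[\ ], M\ \vec N\rangle\rightsquigarrow\langle C[\ ], M'\ \vec N\rangle$. $\rightsquigarrow^*$ is the reflexive-transitive closure of $\rightsquigarrow$. -}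

module Defs where

open import Data.Nat using (ℕ; zero; suc; _≟_)
open import Data.Fin using (Fin; zero; suc; fromℕ; inject₁)
open import Data.List using (List; []; _∷_; foldl)
open import Data.List.Relation.Unary.All using (All)
open import Data.Product using (Σ; ∃; _×_)
open import Relation.Binary.PropositionalEquality using (_≡_)
open import Relation.Binary.Construct.Closure.ReflexiveTransitive using (Star)
open import Relation.Nullary using (¬_; yes; no)

-- Untyped λ-terms, locally nameless / well-scoped:
-- free variables are names (ℕ), bound variables are de Bruijn indices
-- (index 0 = innermost binder).  Tm n = terms with n binders in scope.
-- Λ = Tm 0; α-equivalent terms are syntactically equal.

Name : Set
Name = ℕ

data Tm (n : ℕ) : Set where
  fv  : Name → Tm n
  bv  : Fin n → Tm n
  _·_ : Tm n → Tm n → Tm n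
  ƛ   : Tm (suc n) → Tm n

infixl 7 _·_

Λ : Set
Λ = Tm 0

extR : ∀ {n m} → (Fin n → Fin m) → Fin (suc n) → Fin (suc m)
extR ρ zero    = zero
extR ρ (suc i) = suc (ρ i)

ren : ∀ {n m} → (Fin n → Fin m) → Tm n → Tm m
ren ρ (fv x)  = fv x
ren ρ (bv i)  = bv (ρ i)
ren ρ (M · N) = ren ρ M · ren ρ N
ren ρ (ƛ M)   = ƛ (ren (extR ρ) M)

exts : ∀ {n m} → (Fin n → Tm m) → Fin (suc n) → Tm (suc m)
exts σ zero    = bv zero
exts σ (suc i) = ren suc (σ i)

sub : ∀ {n m} → (Fin n → Tm m) → Tm n → Tm m
sub σ (fv x)  = fv x
sub σ (bv i)  = σ i
sub σ (M · N) = sub σ M · sub σ N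
sub σ (ƛ M)   = ƛ (sub (exts σ) M)

single : ∀ {n} → Tm n → Fin (suc n) → Tm n
single N zero    = N
single N (suc i) = bv i

_[_] : ∀ {n} → Tm (suc n) → Tm n → Tm n
M [ N ] = sub (single N) M

data _→β_ {n : ℕ} : Tm n → Tm n → Set where
  β    : ∀ {M : Tm (suc n)} {N} → (ƛ M · N) →β (M [ N ])
  appL : ∀ {M M' N} → M →β M' → (M · N) →β (M' · N)
  appR : ∀ {M N N'} → N →β N' → (M · N) →β (M · N')
  lam  : ∀ {M M' : Tm (suc n)} → M →β M' → ƛ M →β ƛ M'

_→β*_ : Λ → Λ → Set
_→β*_ = Star _→β_

NF : Λ → Set
NF M = ¬ (∃ λ M' → M →β M')

data _∈fv_ (x : Name) : ∀ {n} → Tm n → Set where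
  here : ∀ {n} → x ∈fv (fv {n} x)
  inL  : ∀ {n} {M N : Tm n} → x ∈fv M → x ∈fv (M · N)
  inR  : ∀ {n} {M N : Tm n} → x ∈fv N → x ∈fv (M · N)
  inƛ  : ∀ {n} {M : Tm (suc n)} → x ∈fv M → x ∈fv (ƛ M)

-- binding the name x: free occurrences of x become the (outermost) index
close : ∀ {n} → Name → Tm n → Tm (suc n)
close {n} x (fv y) with x ≟ y
... | yes _ = bv (fromℕ n)
... | no  _ = fv y
close x (bv i)  = bv (inject₁ i)
close x (M · N) = close x M · close x N
close x (ƛ M)   = ƛ (close x M)

-- Contexts (λ-terms with exactly one hole; binders are named, so
-- plugging captures variables)

data Ctx : Set where
  □     : Ctx
  ƛ[_]_ : Name → Ctx → Ctx
  _·ₗ_  : Ctx → Λ → Ctx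
  _·ᵣ_  : Λ → Ctx → Ctx

plug : Ctx → Λ → Λ
plug □           M = M
plug (ƛ[ x ] C)  M = ƛ (close x (plug C M))
plug (C ·ₗ N)    M = plug C M · N
plug (N ·ᵣ C)    M = N · plug C M

plugᶜ : Ctx → Ctx → Ctx
plugᶜ □          D = D
plugᶜ (ƛ[ x ] C) D = ƛ[ x ] plugᶜ C D
plugᶜ (C ·ₗ N)   D = plugᶜ C D ·ₗ N
plugᶜ (N ·ᵣ C)   D = N ·ᵣ plugᶜ C D

-- Extended terms: with atoms ⌜ M ⌝ (M ∈ Λ, no free variables,
-- unchanged by substitution) and the brackets ⟨ C , M ⟩ of Λ^rb
-- (formal application is ordinary application _∙_).

data Ex (n : ℕ) : Set where
  bvᵉ   : Fin n → Ex n
  ⌜_⌝   : Λ → Ex n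
  _∙_   : Ex n → Ex n → Ex n
  ƛᵉ    : Ex (suc n) → Ex n
  ⟨_,_⟩ : Ctx → Ex 0 → Ex n

infixl 7 _∙_

renᵉ : ∀ {n m} → (Fin n → Fin m) → Ex n → Ex m
renᵉ ρ (bvᵉ i)     = bvᵉ (ρ i)
renᵉ ρ ⌜ M ⌝       = ⌜ M ⌝
renᵉ ρ (M ∙ N)     = renᵉ ρ M ∙ renᵉ ρ N
renᵉ ρ (ƛᵉ M)      = ƛᵉ (renᵉ (extR ρ) M)
renᵉ ρ ⟨ C , M ⟩   = ⟨ C , M ⟩

extsᵉ : ∀ {n m} → (Fin n → Ex m) → Fin (suc n) → Ex (suc m)
extsᵉ σ zero    = bvᵉ zero
extsᵉ σ (suc i) = renᵉ suc (σ i)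

subᵉ : ∀ {n m} → (Fin n → Ex m) → Ex n → Ex m
subᵉ σ (bvᵉ i)   = σ i
subᵉ σ ⌜ M ⌝     = ⌜ M ⌝
subᵉ σ (M ∙ N)   = subᵉ σ M ∙ subᵉ σ N
subᵉ σ (ƛᵉ M)    = ƛᵉ (subᵉ (extsᵉ σ) M)
subᵉ σ ⟨ C , M ⟩ = ⟨ C , M ⟩

singleᵉ : ∀ {n} → Ex n → Fin (suc n) → Ex n
singleᵉ N zero    = N
singleᵉ N (suc i) = bvᵉ i

_[_]ᵉ : ∀ {n} → Ex (suc n) → Ex n → Ex n
M [ N ]ᵉ = subᵉ (singleᵉ N) M

_• : ∀ {n} → Tm n → Ex n
fv x    • = ⌜ fv x ⌝
bv i    • = bvᵉ i
(M · N) • = (M •) ∙ (N •)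
ƛ M     • = ƛᵉ (M •)

InΛ• : Ex 0 → Set
InΛ• E = Σ Λ (λ M → (M •) ≡ E)

data _∈atoms_ (x : Name) : ∀ {n} → Ex n → Set where
  atom : ∀ {n} {M : Λ} → x ∈fv M → x ∈atoms (⌜_⌝ {n} M)
  inL  : ∀ {n} {M N : Ex n} → x ∈atoms M → x ∈atoms (M ∙ N)
  inR  : ∀ {n} {M N : Ex n} → x ∈atoms N → x ∈atoms (M ∙ N)
  inƛ  : ∀ {n} {M : Ex (suc n)} → x ∈atoms M → x ∈atoms (ƛᵉ M)

apps : Ex 0 → List (Ex 0) → Ex 0
apps = foldl _∙_

data InΛrb : Ex 0 → Set where
  rb-atom : (M : Λ) → InΛrb ⌜ M ⌝
  rb-bul  : (C : Ctx) {M : Ex 0} → InΛ• M → InΛrb ⟨ C , M ⟩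
  rb-app  : (C : Ctx) {M : Ex 0} {Ns : List (Ex 0)} →
            InΛrb M → All InΛ• Ns → InΛrb ⟨ C , apps M Ns ⟩

data _⇝_ : Ex 0 → Ex 0 → Set where
  r1 : ∀ (C : Ctx) (M : Λ) → ⟨ C , ⌜ M ⌝ ⟩ ⇝ ⌜ plug C M ⌝
  -- the bound variable x is chosen fresh for the atoms of the body
  -- (variable convention)
  r2 : ∀ (C : Ctx) (M : Ex 1) (x : Name) → InΛ• (ƛᵉ M) → ¬ (x ∈atoms M) →
       ⟨ C , ƛᵉ M ⟩ ⇝ ⟨ plugᶜ C (ƛ[ x ] □) , M [ ⌜ fv x ⌝ ]ᵉ ⟩
  r3 : ∀ (C : Ctx) (M : Λ) (N₀ : Ex 0) (Ns : List (Ex 0)) →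
       InΛ• N₀ → All InΛ• Ns →
       ⟨ C , apps (⌜ M ⌝ ∙ N₀) Ns ⟩ ⇝ ⟨ C , apps ⟨ M ·ᵣ □ , N₀ ⟩ Ns ⟩
  r4 : ∀ (C : Ctx) (M : Ex 1) (N₀ : Ex 0) (Ns : List (Ex 0)) →
       InΛ• (ƛᵉ M) → InΛ• N₀ → All InΛ• Ns →
       ⟨ C , apps (ƛᵉ M ∙ N₀) Ns ⟩ ⇝ ⟨ C , apps (M [ N₀ ]ᵉ) Ns ⟩
  r5 : ∀ (C : Ctx) {M M' : Ex 0} (Ns : List (Ex 0)) →
       InΛrb M → InΛrb M' → M ⇝ M' → All InΛ• Ns →
       ⟨ C , apps M Ns ⟩ ⇝ ⟨ C , apps M' Ns ⟩

_⇝*_ : Ex 0 → Ex 0 → Set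
_⇝*_ = Star _⇝_

-- Reading a state back as a λ-term, by plugging the content of every bracket
-- into its context, turns each machine step into at most one β-step.  The
-- contexts the machine builds consist of λs and arguments of neutral terms,
-- and an atom produced inside a bracket is always neutral; hence the final
-- atom is β-normal.  Conversely, if M →β* N with N normal then, by Takahashi's
-- parallel-reduction proof of standardisation, normal-order evaluation takes M
-- to N, and the machine simulates normal-order evaluation step by step,
-- naming each binder it enters by a fresh name.

module Submission where

open import Defs
open import Data.Product using (_×_)
open import Function.Bundles using (_⇔_)

open import Data.Empty using (⊥-elim)
open import Data.Fin using (Fin; zero; suc; fromℕ; inject₁)
open import Data.List using (List; []; _∷_; foldl; map)
open import Data.List.Relation.Unary.All using (All; []; _∷_)
open import Data.Nat using (ℕ; zero; suc; _≟_; _≤_; _⊔_; s≤s)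
open import Data.Nat.Properties using (≤-refl; ≤-trans; m≤m⊔n; m≤n⊔m; <⇒≢)
open import Data.Product using (∃; ∃₂; _,_; uncurry)
open import Data.Sum using (_⊎_; inj₁; inj₂)
open import Data.Vec.Functional using (Vector) renaming (_∷_ to _∷ᵥ_)
open import Data.Vec.Functional.Properties using (∷-cong)
open import Data.Vec.Functional.Relation.Binary.Pointwise using (Pointwise)
open import Function.Base using (_∘_; id)
open import Function.Bundles using (mk⇔)
open import Relation.Binary.Construct.Closure.ReflexiveTransitive
  using (Star; ε; _◅_; _◅◅_; gmap; kleisliStar; return)
open import Relation.Binary.Construct.Closure.ReflexiveTransitive.Properties using (reflexive)
open import Relation.Binary.PropositionalEquality
  using (_≡_; _≢_; _≗_; refl; sym; trans; cong; cong₂; subst; subst₂; module ≡-Reasoning)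
open import Relation.Nullary using (¬_; yes; no)

open ≡-Reasoning

-- Substitution

extR-cong : ∀ {n m} {ρ ρ' : Fin n → Fin m} → ρ ≗ ρ' → extR ρ ≗ extR ρ'
extR-cong e zero    = refl
extR-cong e (suc i) = cong suc (e i)

ren-cong : ∀ {n m} {ρ ρ' : Fin n → Fin m} → ρ ≗ ρ' → ren ρ ≗ ren ρ'
ren-cong e (fv x)  = refl
ren-cong e (bv i)  = cong bv (e i)
ren-cong e (M · N) = cong₂ _·_ (ren-cong e M) (ren-cong e N)
ren-cong e (ƛ M)   = cong ƛ (ren-cong (extR-cong e) M)

extR-∘ : ∀ {n m k} (ρ₂ : Fin m → Fin k) (ρ₁ : Fin n → Fin m) →
         extR ρ₂ ∘ extR ρ₁ ≗ extR (ρ₂ ∘ ρ₁)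
extR-∘ ρ₂ ρ₁ zero    = refl
extR-∘ ρ₂ ρ₁ (suc i) = refl

ren-∘ : ∀ {n m k} (ρ₂ : Fin m → Fin k) (ρ₁ : Fin n → Fin m) (M : Tm n) →
        ren ρ₂ (ren ρ₁ M) ≡ ren (ρ₂ ∘ ρ₁) M
ren-∘ ρ₂ ρ₁ (fv x)  = refl
ren-∘ ρ₂ ρ₁ (bv i)  = refl
ren-∘ ρ₂ ρ₁ (M · N) = cong₂ _·_ (ren-∘ ρ₂ ρ₁ M) (ren-∘ ρ₂ ρ₁ N)
ren-∘ ρ₂ ρ₁ (ƛ M)   =
  cong ƛ (trans (ren-∘ (extR ρ₂) (extR ρ₁) M) (ren-cong (extR-∘ ρ₂ ρ₁) M))

extR-id : ∀ {n} {ρ : Fin n → Fin n} → ρ ≗ id → extR ρ ≗ id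
extR-id e zero    = refl
extR-id e (suc i) = cong suc (e i)

ren-id : ∀ {n} {ρ : Fin n → Fin n} → ρ ≗ id → (M : Tm n) → ren ρ M ≡ M
ren-id e (fv x)  = refl
ren-id e (bv i)  = cong bv (e i)
ren-id e (M · N) = cong₂ _·_ (ren-id e M) (ren-id e N)
ren-id e (ƛ M)   = cong ƛ (ren-id (extR-id e) M)

-- One operation covers sub, ren and close, so their interaction laws all
-- follow from the composition law gsub-gsub.
gsub : ∀ {n m} → (Name → Tm m) → (Fin n → Tm m) → Tm n → Tm m
gsub ρ σ (fv x)  = ρ x
gsub ρ σ (bv i)  = σ i
gsub ρ σ (M · N) = gsub ρ σ M · gsub ρ σ N
gsub ρ σ (ƛ M)   = ƛ (gsub (ren suc ∘ ρ) (exts σ) M)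

exts-cong : ∀ {n m} {σ σ' : Fin n → Tm m} → σ ≗ σ' → exts σ ≗ exts σ'
exts-cong e zero    = refl
exts-cong e (suc i) = cong (ren suc) (e i)

gsub-cong-fv : ∀ {n m} {ρ ρ' : Name → Tm m} {σ σ' : Fin n → Tm m} (M : Tm n) →
               (∀ y → y ∈fv M → ρ y ≡ ρ' y) → σ ≗ σ' → gsub ρ σ M ≡ gsub ρ' σ' M
gsub-cong-fv (fv x)  eρ eσ = eρ x here
gsub-cong-fv (bv i)  eρ eσ = eσ i
gsub-cong-fv (M · N) eρ eσ =
  cong₂ _·_ (gsub-cong-fv M (λ y → eρ y ∘ inL) eσ) (gsub-cong-fv N (λ y → eρ y ∘ inR) eσ)
gsub-cong-fv (ƛ M)   eρ eσ =
  cong ƛ (gsub-cong-fv M (λ y → cong (ren suc) ∘ eρ y ∘ inƛ) (exts-cong eσ))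

gsub-cong : ∀ {n m} {ρ ρ' : Name → Tm m} {σ σ' : Fin n → Tm m} →
            ρ ≗ ρ' → σ ≗ σ' → gsub ρ σ ≗ gsub ρ' σ'
gsub-cong eρ eσ M = gsub-cong-fv M (λ y _ → eρ y) eσ

gsub-ren : ∀ {n m k} (ρ : Name → Tm k) (σ : Fin m → Tm k) (r : Fin n → Fin m) (M : Tm n) →
           gsub ρ σ (ren r M) ≡ gsub ρ (σ ∘ r) M
gsub-ren ρ σ r (fv x)  = refl
gsub-ren ρ σ r (bv i)  = refl
gsub-ren ρ σ r (M · N) = cong₂ _·_ (gsub-ren ρ σ r M) (gsub-ren ρ σ r N)
gsub-ren ρ σ r (ƛ M)   =
  cong ƛ (trans (gsub-ren (ren suc ∘ ρ) (exts σ) (extR r) M) (gsub-cong (λ _ → refl) exts-extR M))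
  where
  exts-extR : exts σ ∘ extR r ≗ exts (σ ∘ r)
  exts-extR zero    = refl
  exts-extR (suc i) = refl

ren-extR-suc : ∀ {n m} (r : Fin n → Fin m) (M : Tm n) →
               ren (extR r) (ren suc M) ≡ ren suc (ren r M)
ren-extR-suc r M = trans (ren-∘ (extR r) suc M) (sym (ren-∘ suc r M))

ren-gsub : ∀ {n m k} (r : Fin m → Fin k) (ρ : Name → Tm m) (σ : Fin n → Tm m) (M : Tm n) →
           ren r (gsub ρ σ M) ≡ gsub (ren r ∘ ρ) (ren r ∘ σ) M
ren-gsub r ρ σ (fv x)  = refl
ren-gsub r ρ σ (bv i)  = refl
ren-gsub r ρ σ (M · N) = cong₂ _·_ (ren-gsub r ρ σ M) (ren-gsub r ρ σ N)
ren-gsub r ρ σ (ƛ M)   =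
  cong ƛ (trans (ren-gsub (extR r) (ren suc ∘ ρ) (exts σ) M)
                (gsub-cong (ren-extR-suc r ∘ ρ) ren-exts M))
  where
  ren-exts : ren (extR r) ∘ exts σ ≗ exts (ren r ∘ σ)
  ren-exts zero    = refl
  ren-exts (suc i) = ren-extR-suc r (σ i)

gsub-gsub : ∀ {n m k} (ρ₂ : Name → Tm k) (σ₂ : Fin m → Tm k)
              (ρ₁ : Name → Tm m) (σ₁ : Fin n → Tm m) (M : Tm n) →
            gsub ρ₂ σ₂ (gsub ρ₁ σ₁ M) ≡ gsub (gsub ρ₂ σ₂ ∘ ρ₁) (gsub ρ₂ σ₂ ∘ σ₁) M
gsub-gsub ρ₂ σ₂ ρ₁ σ₁ (fv x)  = refl
gsub-gsub ρ₂ σ₂ ρ₁ σ₁ (bv i)  = refl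
gsub-gsub ρ₂ σ₂ ρ₁ σ₁ (M · N) = cong₂ _·_ (gsub-gsub ρ₂ σ₂ ρ₁ σ₁ M) (gsub-gsub ρ₂ σ₂ ρ₁ σ₁ N)
gsub-gsub ρ₂ σ₂ ρ₁ σ₁ (ƛ M)   =
  cong ƛ (trans (gsub-gsub (ren suc ∘ ρ₂) (exts σ₂) (ren suc ∘ ρ₁) (exts σ₁) M)
                (gsub-cong (gsub-ren-suc ∘ ρ₁) gsub-exts M))
  where
  gsub-ren-suc : ∀ M → gsub (ren suc ∘ ρ₂) (exts σ₂) (ren suc M) ≡ ren suc (gsub ρ₂ σ₂ M)
  gsub-ren-suc M = trans (gsub-ren (ren suc ∘ ρ₂) (exts σ₂) suc M) (sym (ren-gsub suc ρ₂ σ₂ M))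
  gsub-exts : gsub (ren suc ∘ ρ₂) (exts σ₂) ∘ exts σ₁ ≗ exts (gsub ρ₂ σ₂ ∘ σ₁)
  gsub-exts zero    = refl
  gsub-exts (suc i) = gsub-ren-suc (σ₁ i)

gsub-id : ∀ {n} {ρ : Name → Tm n} {σ : Fin n → Tm n} (M : Tm n) →
          (∀ y → y ∈fv M → ρ y ≡ fv y) → σ ≗ bv → gsub ρ σ M ≡ M
gsub-id M eρ eσ = trans (gsub-cong-fv M eρ eσ) (gsub-fv-bv M)
  where
  gsub-fv-bv : ∀ {n} (M : Tm n) → gsub fv bv M ≡ M
  gsub-fv-bv (fv x)  = refl
  gsub-fv-bv (bv i)  = refl
  gsub-fv-bv (M · N) = cong₂ _·_ (gsub-fv-bv M) (gsub-fv-bv N)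
  gsub-fv-bv (ƛ M)   = cong ƛ (trans (gsub-cong (λ _ → refl) exts-bv M) (gsub-fv-bv M))
    where
    exts-bv : exts bv ≗ bv
    exts-bv zero    = refl
    exts-bv (suc i) = refl

sub-as-gsub : ∀ {n m} (σ : Fin n → Tm m) → sub σ ≗ gsub fv σ
sub-as-gsub σ (fv x)  = refl
sub-as-gsub σ (bv i)  = refl
sub-as-gsub σ (M · N) = cong₂ _·_ (sub-as-gsub σ M) (sub-as-gsub σ N)
sub-as-gsub σ (ƛ M)   = cong ƛ (sub-as-gsub (exts σ) M)

ren-as-gsub : ∀ {n m} (r : Fin n → Fin m) → ren r ≗ gsub fv (bv ∘ r)
ren-as-gsub r (fv x)  = refl
ren-as-gsub r (bv i)  = refl
ren-as-gsub r (M · N) = cong₂ _·_ (ren-as-gsub r M) (ren-as-gsub r N)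
ren-as-gsub r (ƛ M)   =
  cong ƛ (trans (ren-as-gsub (extR r) M) (gsub-cong (λ _ → refl) bv-extR M))
  where
  bv-extR : bv ∘ extR r ≗ exts (bv ∘ r)
  bv-extR zero    = refl
  bv-extR (suc i) = refl

bindName : ∀ {n} → Name → Name → Tm (suc n)
bindName {n} x y with x ≟ y
... | yes _ = bv (fromℕ n)
... | no  _ = fv y

close-as-gsub : ∀ {n} (x : Name) → close {n} x ≗ gsub (bindName x) (bv ∘ inject₁)
close-as-gsub {n} x (fv y) with x ≟ y
... | yes _ = refl
... | no  _ = refl
close-as-gsub x (bv i)  = refl
close-as-gsub x (M · N) = cong₂ _·_ (close-as-gsub x M) (close-as-gsub x N)
close-as-gsub {n} x (ƛ M) =
  cong ƛ (trans (close-as-gsub x M) (gsub-cong bindName-suc bv-inject₁ M))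
  where
  bindName-suc : bindName {suc n} x ≗ ren suc ∘ bindName {n} x
  bindName-suc y with x ≟ y
  ... | yes _ = refl
  ... | no  _ = refl
  bv-inject₁ : bv ∘ inject₁ ≗ exts (bv ∘ inject₁ {n})
  bv-inject₁ zero    = refl
  bv-inject₁ (suc i) = refl

sub-cong : ∀ {n m} {σ σ' : Fin n → Tm m} → σ ≗ σ' → sub σ ≗ sub σ'
sub-cong {σ = σ} {σ'} e M =
  trans (sub-as-gsub σ M) (trans (gsub-cong (λ _ → refl) e M) (sym (sub-as-gsub σ' M)))

sub-id : ∀ {n} (M : Tm n) → sub bv M ≡ M
sub-id M = trans (sub-as-gsub bv M) (gsub-id M (λ _ _ → refl) (λ _ → refl))

sub-empty : {σ : Fin 0 → Λ} (M : Λ) → sub σ M ≡ M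
sub-empty M = trans (sub-cong (λ ()) M) (sub-id M)

sub-sub : ∀ {n m k} (τ : Fin m → Tm k) (σ : Fin n → Tm m) (M : Tm n) →
          sub τ (sub σ M) ≡ sub (sub τ ∘ σ) M
sub-sub τ σ M = begin
  sub τ (sub σ M)                    ≡⟨ sub-as-gsub τ (sub σ M) ⟩
  gsub fv τ (sub σ M)                ≡⟨ cong (gsub fv τ) (sub-as-gsub σ M) ⟩
  gsub fv τ (gsub fv σ M)            ≡⟨ gsub-gsub fv τ fv σ M ⟩
  gsub fv (gsub fv τ ∘ σ) M          ≡⟨ gsub-cong (λ _ → refl) (sym ∘ sub-as-gsub τ ∘ σ) M ⟩
  gsub fv (sub τ ∘ σ) M              ≡⟨ sub-as-gsub (sub τ ∘ σ) M ⟨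
  sub (sub τ ∘ σ) M                  ∎

ren-suc-[] : ∀ {n} (M K : Tm n) → ren suc M [ K ] ≡ M
ren-suc-[] M K = begin
  sub (single K) (ren suc M)         ≡⟨ sub-as-gsub (single K) (ren suc M) ⟩
  gsub fv (single K) (ren suc M)     ≡⟨ gsub-ren fv (single K) suc M ⟩
  gsub fv bv M                       ≡⟨ gsub-id M (λ _ _ → refl) (λ _ → refl) ⟩
  M                                  ∎

gsub-[] : ∀ {n m} (ρ : Name → Tm m) (σ : Fin n → Tm m) (M : Tm (suc n)) (N : Tm n) →
          gsub ρ σ (M [ N ]) ≡ gsub (ren suc ∘ ρ) (exts σ) M [ gsub ρ σ N ]
gsub-[] ρ σ M N = begin
  gsub ρ σ (sub (single N) M)
    ≡⟨ cong (gsub ρ σ) (sub-as-gsub (single N) M) ⟩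
  gsub ρ σ (gsub fv (single N) M)
    ≡⟨ gsub-gsub ρ σ fv (single N) M ⟩
  gsub ρ (gsub ρ σ ∘ single N) M
    ≡⟨ gsub-cong (λ y → sym (ren-suc-[] (ρ y) N')) single-exts M ⟩
  gsub (sub (single N') ∘ ren suc ∘ ρ) (sub (single N') ∘ exts σ) M
    ≡⟨ gsub-cong (sub-as-gsub (single N') ∘ ren suc ∘ ρ) (sub-as-gsub (single N') ∘ exts σ) M ⟩
  gsub (gsub fv (single N') ∘ ren suc ∘ ρ) (gsub fv (single N') ∘ exts σ) M
    ≡⟨ gsub-gsub fv (single N') (ren suc ∘ ρ) (exts σ) M ⟨
  gsub fv (single N') (gsub (ren suc ∘ ρ) (exts σ) M)
    ≡⟨ sub-as-gsub (single N') (gsub (ren suc ∘ ρ) (exts σ) M) ⟨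
  gsub (ren suc ∘ ρ) (exts σ) M [ N' ]
    ∎
  where
  N' = gsub ρ σ N
  single-exts : gsub ρ σ ∘ single N ≗ sub (single N') ∘ exts σ
  single-exts zero    = refl
  single-exts (suc i) = sym (ren-suc-[] (σ i) N')

sub-[] : ∀ {n m} (σ : Fin n → Tm m) (M : Tm (suc n)) (N : Tm n) →
         sub σ (M [ N ]) ≡ sub (exts σ) M [ sub σ N ]
sub-[] σ M N = begin
  sub σ (M [ N ])                          ≡⟨ sub-as-gsub σ (M [ N ]) ⟩
  gsub fv σ (M [ N ])                      ≡⟨ gsub-[] fv σ M N ⟩
  gsub fv (exts σ) M [ gsub fv σ N ]       ≡⟨ cong₂ _[_] (sub-as-gsub (exts σ) M) (sub-as-gsub σ N) ⟨
  sub (exts σ) M [ sub σ N ]               ∎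

ren-[] : ∀ {n m} (r : Fin n → Fin m) (M : Tm (suc n)) (N : Tm n) →
         ren r (M [ N ]) ≡ ren (extR r) M [ ren r N ]
ren-[] r M N = begin
  ren r (M [ N ])                                ≡⟨ ren-as-gsub r (M [ N ]) ⟩
  gsub fv (bv ∘ r) (M [ N ])                     ≡⟨ gsub-[] fv (bv ∘ r) M N ⟩
  gsub fv (exts (bv ∘ r)) M [ gsub fv (bv ∘ r) N ] ≡⟨ cong₂ _[_] ren-extR (ren-as-gsub r N) ⟨
  ren (extR r) M [ ren r N ]                     ∎
  where
  exts-bv : exts (bv ∘ r) ≗ bv ∘ extR r
  exts-bv zero    = refl
  exts-bv (suc i) = refl
  ren-extR : ren (extR r) M ≡ gsub fv (exts (bv ∘ r)) M
  ren-extR = trans (ren-as-gsub (extR r) M) (gsub-cong (λ _ → refl) (sym ∘ exts-bv) M)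

exts-[] : ∀ {n m} (σ : Fin n → Tm m) (M : Tm (suc n)) (K : Tm m) →
          sub (exts σ) M [ K ] ≡ sub (K ∷ᵥ σ) M
exts-[] σ M K = trans (sub-sub (single K) (exts σ) M) (sub-cong single-exts M)
  where
  single-exts : sub (single K) ∘ exts σ ≗ K ∷ᵥ σ
  single-exts zero    = refl
  single-exts (suc i) = ren-suc-[] (σ i) K

close-∷ : ∀ {n} (x : Name) (σ : Fin n → Name) (N : Tm (suc n)) →
          ¬ x ∈fv N → (∀ i → σ i ≢ x) →
          close x (sub (fv ∘ (x ∷ᵥ σ)) N) ≡ sub (exts (fv ∘ σ)) N
close-∷ x σ N x∉N σ≢x = begin
  close x (sub (fv ∘ (x ∷ᵥ σ)) N)
    ≡⟨ close-as-gsub x (sub (fv ∘ (x ∷ᵥ σ)) N) ⟩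
  gsub (bindName x) (bv ∘ inject₁) (sub (fv ∘ (x ∷ᵥ σ)) N)
    ≡⟨ cong (gsub (bindName x) (bv ∘ inject₁)) (sub-as-gsub _ N) ⟩
  gsub (bindName x) (bv ∘ inject₁) (gsub fv (fv ∘ (x ∷ᵥ σ)) N)
    ≡⟨ gsub-gsub (bindName x) (bv ∘ inject₁) fv (fv ∘ (x ∷ᵥ σ)) N ⟩
  gsub (bindName x) (bindName x ∘ (x ∷ᵥ σ)) N
    ≡⟨ gsub-cong-fv N bind-other bind-∷ ⟩
  gsub fv (exts (fv ∘ σ)) N
    ≡⟨ sub-as-gsub _ N ⟨
  sub (exts (fv ∘ σ)) N
    ∎
  where
  bind-other : ∀ y → y ∈fv N → bindName x y ≡ fv y
  bind-other y y∈N with x ≟ y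
  ... | yes refl = ⊥-elim (x∉N y∈N)
  ... | no  _    = refl
  bind-∷ : bindName x ∘ (x ∷ᵥ σ) ≗ exts (fv ∘ σ)
  bind-∷ zero with x ≟ x
  ... | yes _  = refl
  ... | no x≢x = ⊥-elim (x≢x refl)
  bind-∷ (suc i) with x ≟ σ i
  ... | yes x≡σi = ⊥-elim (σ≢x i (sym x≡σi))
  ... | no  _    = refl

close-[fv] : (x : Name) (P : Tm 1) → ¬ x ∈fv P → close x (P [ fv x ]) ≡ P
close-[fv] x P x∉P = begin
  close x (P [ fv x ])              ≡⟨ cong (close x) (sub-cong single-∷ P) ⟩
  close x (sub (fv ∘ (x ∷ᵥ σ₀)) P) ≡⟨ close-∷ x σ₀ P x∉P (λ ()) ⟩
  sub (exts (fv ∘ σ₀)) P            ≡⟨ sub-cong exts-bv P ⟩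
  sub bv P                          ≡⟨ sub-id P ⟩
  P                                 ∎
  where
  σ₀ : Fin 0 → Name
  σ₀ ()
  single-∷ : single (fv x) ≗ fv ∘ (x ∷ᵥ σ₀)
  single-∷ zero = refl
  exts-bv : exts (fv ∘ σ₀) ≗ bv
  exts-bv zero = refl

gsub-→β : ∀ {n m} (ρ : Name → Tm m) (σ : Fin n → Tm m) {M M' : Tm n} →
          M →β M' → gsub ρ σ M →β gsub ρ σ M'
gsub-→β ρ σ (β {M} {N}) = subst ((ƛ _ · _) →β_) (sym (gsub-[] ρ σ M N)) β
gsub-→β ρ σ (appL s)    = appL (gsub-→β ρ σ s)
gsub-→β ρ σ (appR s)    = appR (gsub-→β ρ σ s)
gsub-→β ρ σ (lam s)     = lam (gsub-→β (ren suc ∘ ρ) (exts σ) s)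

close-→β : ∀ {n} (x : Name) {M M' : Tm n} → M →β M' → close x M →β close x M'
close-→β x {M} {M'} s =
  subst₂ _→β_ (sym (close-as-gsub x M)) (sym (close-as-gsub x M')) (gsub-→β _ _ s)

plug-→β : (C : Ctx) {M M' : Λ} → M →β M' → plug C M →β plug C M'
plug-→β □          s = s
plug-→β (ƛ[ x ] C) s = lam (close-→β x (plug-→β C s))
plug-→β (C ·ₗ N)   s = appL (plug-→β C s)
plug-→β (N ·ᵣ C)   s = appR (plug-→β C s)

plug-plugᶜ : (C D : Ctx) (M : Λ) → plug (plugᶜ C D) M ≡ plug C (plug D M)
plug-plugᶜ □          D M = refl
plug-plugᶜ (ƛ[ x ] C) D M = cong (ƛ ∘ close x) (plug-plugᶜ C D M)
plug-plugᶜ (C ·ₗ N)   D M = cong (_· N) (plug-plugᶜ C D M)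
plug-plugᶜ (N ·ᵣ C)   D M = cong (N ·_) (plug-plugᶜ C D M)

plugᶜ-□ : (C : Ctx) → plugᶜ C □ ≡ C
plugᶜ-□ □          = refl
plugᶜ-□ (ƛ[ x ] C) = cong (ƛ[ x ]_) (plugᶜ-□ C)
plugᶜ-□ (C ·ₗ N)   = cong (_·ₗ N) (plugᶜ-□ C)
plugᶜ-□ (N ·ᵣ C)   = cong (N ·ᵣ_) (plugᶜ-□ C)

-- β-normal forms

data Ne {n : ℕ} : Tm n → Set
data Nf {n : ℕ} : Tm n → Set

data Ne {n} where
  ne-fv  : ∀ x → Ne (fv x)
  ne-bv  : ∀ i → Ne (bv i)
  ne-app : ∀ {M N} → Ne M → Nf N → Ne (M · N)

data Nf {n} where
  nf-ne  : ∀ {M} → Ne M → Nf M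
  nf-lam : ∀ {M} → Nf M → Nf (ƛ M)

ne-irreducible : ∀ {n} {M M' : Tm n} → Ne M → ¬ (M →β M')
nf-irreducible : ∀ {n} {M M' : Tm n} → Nf M → ¬ (M →β M')

ne-irreducible (ne-app () _) β
ne-irreducible (ne-app h _) (appL s) = ne-irreducible h s
ne-irreducible (ne-app _ h) (appR s) = nf-irreducible h s

nf-irreducible (nf-ne h)  s       = ne-irreducible h s
nf-irreducible (nf-lam h) (lam s) = nf-irreducible h s

Nf-or-→β : ∀ {n} (M : Tm n) → Nf M ⊎ ∃ (λ M' → M →β M')
Nf-or-→β (fv x) = inj₁ (nf-ne (ne-fv x))
Nf-or-→β (bv i) = inj₁ (nf-ne (ne-bv i))
Nf-or-→β (ƛ M) with Nf-or-→β M
... | inj₁ h        = inj₁ (nf-lam h)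
... | inj₂ (M' , s) = inj₂ (ƛ M' , lam s)
Nf-or-→β (M · N) with Nf-or-→β M
... | inj₂ (M' , s)          = inj₂ (M' · N , appL s)
... | inj₁ (nf-lam {M₀} h)   = inj₂ (M₀ [ N ] , β)
... | inj₁ (nf-ne h) with Nf-or-→β N
...   | inj₁ h'        = inj₁ (nf-ne (ne-app h h'))
...   | inj₂ (N' , s)  = inj₂ (M · N' , appR s)

Nf⇒NF : ∀ {M} → Nf M → NF M
Nf⇒NF h (_ , s) = nf-irreducible h s

NF⇒Nf : ∀ {M} → NF M → Nf M
NF⇒Nf {M} h with Nf-or-→β M
... | inj₁ p = p
... | inj₂ q = ⊥-elim (h q)

close-ne : ∀ {n} (x : Name) {M : Tm n} → Ne M → Ne (close x M)
close-nf : ∀ {n} (x : Name) {M : Tm n} → Nf M → Nf (close x M)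

close-ne x (ne-fv y) with x ≟ y
... | yes _ = ne-bv _
... | no  _ = ne-fv y
close-ne x (ne-bv i)      = ne-bv _
close-ne x (ne-app h h')  = ne-app (close-ne x h) (close-nf x h')

close-nf x (nf-ne h)  = nf-ne (close-ne x h)
close-nf x (nf-lam h) = nf-lam (close-nf x h)

•-ren : ∀ {n m} (r : Fin n → Fin m) (M : Tm n) → renᵉ r (M •) ≡ ren r M •
•-ren r (fv x)  = refl
•-ren r (bv i)  = refl
•-ren r (M · N) = cong₂ _∙_ (•-ren r M) (•-ren r N)
•-ren r (ƛ M)   = cong ƛᵉ (•-ren (extR r) M)

•-sub : ∀ {n m} {τ : Fin n → Ex m} {σ : Fin n → Tm m} → τ ≗ _• ∘ σ →
        (M : Tm n) → subᵉ τ (M •) ≡ sub σ M •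
•-sub e (fv x)  = refl
•-sub e (bv i)  = e i
•-sub e (M · N) = cong₂ _∙_ (•-sub e M) (•-sub e N)
•-sub {τ = τ} {σ} e (ƛ M) = cong ƛᵉ (•-sub extsᵉ-exts M)
  where
  extsᵉ-exts : extsᵉ τ ≗ _• ∘ exts σ
  extsᵉ-exts zero    = refl
  extsᵉ-exts (suc i) = trans (cong (renᵉ suc) (e i)) (•-ren suc (σ i))

•-[] : ∀ {n} (M : Tm (suc n)) (N : Tm n) → (M •) [ N • ]ᵉ ≡ M [ N ] •
•-[] M N = •-sub single-• M
  where
  single-• : singleᵉ (N •) ≗ _• ∘ single N
  single-• zero    = refl
  single-• (suc i) = refl

∈fv⇒∈atoms• : ∀ {n x} {M : Tm n} → x ∈fv M → x ∈atoms (M •)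
∈fv⇒∈atoms• here    = atom here
∈fv⇒∈atoms• (inL p) = inL (∈fv⇒∈atoms• p)
∈fv⇒∈atoms• (inR p) = inR (∈fv⇒∈atoms• p)
∈fv⇒∈atoms• (inƛ p) = inƛ (∈fv⇒∈atoms• p)

∈atoms•⇒∈fv : ∀ {n x} (M : Tm n) → x ∈atoms (M •) → x ∈fv M
∈atoms•⇒∈fv (fv y)  (atom here) = here
∈atoms•⇒∈fv (M · N) (inL p)     = inL (∈atoms•⇒∈fv M p)
∈atoms•⇒∈fv (M · N) (inR p)     = inR (∈atoms•⇒∈fv N p)
∈atoms•⇒∈fv (ƛ M)   (inƛ p)     = inƛ (∈atoms•⇒∈fv M p)

InΛ•-• : (M : Λ) → InΛ• (M •)
InΛ•-• M = M , refl

InΛ•-∙ : ∀ {E N} → InΛ• E → InΛ• N → InΛ• (E ∙ N)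
InΛ•-∙ (P , refl) (Q , refl) = InΛ•-• (P · Q)

InΛ•-apps : ∀ {E} Ns → InΛ• E → All InΛ• Ns → InΛ• (apps E Ns)
InΛ•-apps []       h []       = h
InΛ•-apps (N ∷ Ns) h (p ∷ ps) = InΛ•-apps Ns (InΛ•-∙ h p) ps

InΛ•-[] : ∀ {M N} → InΛ• (ƛᵉ M) → InΛ• N → InΛ• (M [ N ]ᵉ)
InΛ•-[] (ƛ P , refl) (Q , refl) = P [ Q ] , sym (•-[] P Q)

•-irreducible : (M : Λ) {E : Ex 0} → ¬ ((M •) ⇝ E)
•-irreducible (fv x)  ()
•-irreducible (M · N) ()
•-irreducible (ƛ M)   ()

-- Soundness

wk : ∀ {n} → Λ → Tm n
wk = ren (λ ())

wk-Λ : (M : Λ) → wk M ≡ M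
wk-Λ = ren-id (λ ())

⟦_⟧ : ∀ {n} → Ex n → Tm n
⟦ bvᵉ i ⟧     = bv i
⟦ ⌜ M ⌝ ⟧     = wk M
⟦ E ∙ F ⟧     = ⟦ E ⟧ · ⟦ F ⟧
⟦ ƛᵉ E ⟧      = ƛ ⟦ E ⟧
⟦ ⟨ C , E ⟩ ⟧ = wk (plug C ⟦ E ⟧)

⟦•⟧ : ∀ {n} (M : Tm n) → ⟦ M • ⟧ ≡ M
⟦•⟧ (fv x)  = refl
⟦•⟧ (bv i)  = refl
⟦•⟧ (M · N) = cong₂ _·_ (⟦•⟧ M) (⟦•⟧ N)
⟦•⟧ (ƛ M)   = cong ƛ (⟦•⟧ M)

⟦•-[]⟧ : ∀ {n} (M : Tm (suc n)) (N : Tm n) → ⟦ (M •) [ N • ]ᵉ ⟧ ≡ M [ N ]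
⟦•-[]⟧ M N = trans (cong ⟦_⟧ (•-[] M N)) (⟦•⟧ (M [ N ]))

infixl 7 _·*_

_·*_ : Λ → List Λ → Λ
_·*_ = foldl _·_

·*-→β : ∀ {M M'} (Ks : List Λ) → M →β M' → (M ·* Ks) →β (M' ·* Ks)
·*-→β []       s = s
·*-→β (K ∷ Ks) s = ·*-→β Ks (appL s)

⟦apps⟧ : (E : Ex 0) (Ns : List (Ex 0)) → ⟦ apps E Ns ⟧ ≡ ⟦ E ⟧ ·* map ⟦_⟧ Ns
⟦apps⟧ E []       = refl
⟦apps⟧ E (N ∷ Ns) = ⟦apps⟧ (E ∙ N) Ns

⟦⟨⟩⟧ : (C : Ctx) (E : Ex 0) → ⟦ ⟨ C , E ⟩ ⟧ ≡ plug C ⟦ E ⟧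
⟦⟨⟩⟧ C E = wk-Λ (plug C ⟦ E ⟧)

⟦⟨apps⟩⟧-→β* : (C : Ctx) (Ns : List (Ex 0)) {E E' : Ex 0} → ⟦ E ⟧ →β* ⟦ E' ⟧ →
               ⟦ ⟨ C , apps E Ns ⟩ ⟧ →β* ⟦ ⟨ C , apps E' Ns ⟩ ⟧
⟦⟨apps⟩⟧-→β* C Ns {E} {E'} r =
  subst₂ _→β*_ (sym (readback E)) (sym (readback E'))
    (gmap (λ M → plug C (M ·* map ⟦_⟧ Ns)) (plug-→β C ∘ ·*-→β (map ⟦_⟧ Ns)) r)
  where
  readback : ∀ E → ⟦ ⟨ C , apps E Ns ⟩ ⟧ ≡ plug C (⟦ E ⟧ ·* map ⟦_⟧ Ns)
  readback E = trans (⟦⟨⟩⟧ C (apps E Ns)) (cong (plug C) (⟦apps⟧ E Ns))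

-- Rules 1–3 read back to the same term and rule 4 contracts one redex.
⇝-sound : ∀ {S S'} → S ⇝ S' → ⟦ S ⟧ →β* ⟦ S' ⟧
⇝-sound (r1 C M) = reflexive _→β_ (cong wk (cong (plug C) (wk-Λ M)))
⇝-sound (r2 C .(P •) x (ƛ P , refl) x∉P) = reflexive _→β_ (begin
  ⟦ ⟨ C , ƛᵉ (P •) ⟩ ⟧                          ≡⟨ ⟦⟨⟩⟧ C (ƛᵉ (P •)) ⟩
  plug C (ƛ ⟦ P • ⟧)                             ≡⟨ cong (plug C ∘ ƛ) (⟦•⟧ P) ⟩
  plug C (ƛ P)                                   ≡⟨ cong (plug C ∘ ƛ) (close-[fv] x P (x∉P ∘ ∈fv⇒∈atoms•)) ⟨
  plug C (ƛ (close x (P [ fv x ])))              ≡⟨ plug-plugᶜ C (ƛ[ x ] □) (P [ fv x ]) ⟨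
  plug (plugᶜ C (ƛ[ x ] □)) (P [ fv x ])         ≡⟨ cong (plug (plugᶜ C (ƛ[ x ] □))) (⟦•-[]⟧ P (fv x)) ⟨
  plug (plugᶜ C (ƛ[ x ] □)) ⟦ (P •) [ ⌜ fv x ⌝ ]ᵉ ⟧ ≡⟨ ⟦⟨⟩⟧ (plugᶜ C (ƛ[ x ] □)) ((P •) [ ⌜ fv x ⌝ ]ᵉ) ⟨
  ⟦ ⟨ plugᶜ C (ƛ[ x ] □) , (P •) [ ⌜ fv x ⌝ ]ᵉ ⟩ ⟧ ∎)
⇝-sound (r3 C M N₀ Ns _ _) =
  ⟦⟨apps⟩⟧-→β* C Ns (reflexive _→β_ (cong (wk M ·_) (sym (wk-Λ ⟦ N₀ ⟧))))
⇝-sound (r4 C .(P •) .(Q •) Ns (ƛ P , refl) (Q , refl) _) =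
  ⟦⟨apps⟩⟧-→β* C Ns (return (subst₂ _→β_ (cong₂ (λ A B → ƛ A · B) (sym (⟦•⟧ P)) (sym (⟦•⟧ Q)))
                                           (sym (⟦•-[]⟧ P Q)) β))
⇝-sound (r5 C Ns _ _ s _) = ⟦⟨apps⟩⟧-→β* C Ns (⇝-sound s)

⇝*-sound : ∀ {S S'} → S ⇝* S' → ⟦ S ⟧ →β* ⟦ S' ⟧
⇝*-sound = kleisliStar ⟦_⟧ ⇝-sound

data NfCtx : Ctx → Set where
  nc-□  : NfCtx □
  nc-ƛ  : ∀ {C} x → NfCtx C → NfCtx (ƛ[ x ] C)
  nc-·ᵣ : ∀ {K C} → Ne K → NfCtx C → NfCtx (K ·ᵣ C)

plug-Nf : ∀ {C P} → NfCtx C → Nf P → Nf (plug C P)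
plug-Nf nc-□        h = h
plug-Nf (nc-ƛ x c)  h = nf-lam (close-nf x (plug-Nf c h))
plug-Nf (nc-·ᵣ k c) h = nf-ne (ne-app k (plug-Nf c h))

plugᶜ-NfCtx : ∀ {C D} → NfCtx C → NfCtx D → NfCtx (plugᶜ C D)
plugᶜ-NfCtx nc-□        d = d
plugᶜ-NfCtx (nc-ƛ x c)  d = nc-ƛ x (plugᶜ-NfCtx c d)
plugᶜ-NfCtx (nc-·ᵣ k c) d = nc-·ᵣ k (plugᶜ-NfCtx c d)

-- The possible contents of a bracket: any atom they ever turn into is neutral.
data Focus : Ex 0 → Set where
  focus-•    : ∀ {E} → InΛ• E → Focus E
  focus-atom : ∀ {K} → Ne K → Focus ⌜ K ⌝
  focus-⟨⟩   : ∀ {K C E} → Ne K → NfCtx C → Focus E → Focus ⟨ K ·ᵣ C , E ⟩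
  focus-∙    : ∀ {E N} → Focus E → InΛ• N → Focus (E ∙ N)

focus-apps : ∀ {E} Ns → Focus E → All InΛ• Ns → Focus (apps E Ns)
focus-apps []       f []       = f
focus-apps (N ∷ Ns) f (p ∷ ps) = focus-apps Ns (focus-∙ f p) ps

focus-∙⁻ : ∀ {E N} → Focus (E ∙ N) → Focus E
focus-∙⁻ (focus-• (P · Q , refl)) = focus-• (InΛ•-• P)
focus-∙⁻ (focus-∙ f _)            = f

focus-apps⁻ : ∀ {E} Ns → Focus (apps E Ns) → Focus E
focus-apps⁻ []       f = f
focus-apps⁻ (N ∷ Ns) f = focus-∙⁻ (focus-apps⁻ Ns f)

focus-atom⁻ : ∀ {K} → Focus ⌜ K ⌝ → Ne K
focus-atom⁻ (focus-• (fv x , refl)) = ne-fv x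
focus-atom⁻ (focus-atom k)          = k

GoodBelow : Ctx → Ex 0 → Set
GoodBelow C S = (∃₂ λ D E → S ≡ ⟨ plugᶜ C D , E ⟩ × NfCtx D × Focus E)
              ⊎ (∃ λ P → S ≡ ⌜ plug C P ⌝ × Nf P)

goodBelow-here : ∀ {C E} → Focus E → GoodBelow C ⟨ C , E ⟩
goodBelow-here {C} {E} f = inj₁ (□ , E , cong ⟨_, E ⟩ (sym (plugᶜ-□ C)) , nc-□ , f)

goodBelow-□ : ∀ {C S} → NfCtx C → GoodBelow C S → GoodBelow □ S
goodBelow-□ c (inj₁ (D , E , refl , d , f)) = inj₁ (_ , E , refl , plugᶜ-NfCtx c d , f)
goodBelow-□ c (inj₂ (P , refl , h))          = inj₂ (_ , refl , plug-Nf c h)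

bracket-step : ∀ {C E S} → NfCtx C → Focus E → ⟨ C , E ⟩ ⇝ S → GoodBelow C S
focus-step   : ∀ {E E'} → Focus E → E ⇝ E' → Focus E'

bracket-step c f (r1 C M) = inj₂ (M , refl , nf-ne (focus-atom⁻ f))
bracket-step c f (r2 C M x b _) =
  inj₁ (ƛ[ x ] □ , M [ ⌜ fv x ⌝ ]ᵉ , refl , nc-ƛ x nc-□ , focus-• (InΛ•-[] b (InΛ•-• (fv x))))
bracket-step c f (r3 C M N₀ Ns n₀ ns) =
  goodBelow-here (focus-apps Ns (focus-⟨⟩ head nc-□ (focus-• n₀)) ns)
  where head = focus-atom⁻ (focus-∙⁻ (focus-apps⁻ Ns f))
bracket-step c f (r4 C M N₀ Ns b n₀ ns) =
  goodBelow-here (focus-• (InΛ•-apps Ns (InΛ•-[] b n₀) ns))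
bracket-step c f (r5 C Ns _ _ s ns) =
  goodBelow-here (focus-apps Ns (focus-step (focus-apps⁻ Ns f) s) ns)

focus-step (focus-• (M , refl)) s = ⊥-elim (•-irreducible M s)
focus-step (focus-⟨⟩ k c f) s with bracket-step (nc-·ᵣ k c) f s
... | inj₁ (D , E' , refl , d , f') = focus-⟨⟩ k (plugᶜ-NfCtx c d) f'
... | inj₂ (P , refl , h)           = focus-atom (ne-app k (plug-Nf c h))

goodBelow-□-⇝ : ∀ {S S'} → GoodBelow □ S → S ⇝ S' → GoodBelow □ S'
goodBelow-□-⇝ (inj₁ (D , E , refl , d , f)) s = goodBelow-□ d (bracket-step d f s)
goodBelow-□-⇝ (inj₂ (P , refl , _))        ()

goodBelow-□-⇝*-atom : ∀ {S N} → GoodBelow □ S → S ⇝* ⌜ N ⌝ → Nf N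
goodBelow-□-⇝*-atom (inj₂ (P , refl , h)) ε = h
goodBelow-□-⇝*-atom g (s ◅ r) = goodBelow-□-⇝*-atom (goodBelow-□-⇝ g s) r

soundness : ∀ {M N} → ⟨ □ , M • ⟩ ⇝* ⌜ N ⌝ → (M →β* N) × NF N
soundness {M} {N} r =
  subst₂ _→β*_ (trans (wk-Λ ⟦ M • ⟧) (⟦•⟧ M)) (wk-Λ N) (⇝*-sound r) ,
  Nf⇒NF (goodBelow-□-⇝*-atom (goodBelow-here (focus-• (InΛ•-• M))) r)

-- Standardisation

data _→w_ {n : ℕ} : Tm n → Tm n → Set where
  w-β   : ∀ {M : Tm (suc n)} {N} → (ƛ M · N) →w (M [ N ])
  w-app : ∀ {M M' N} → M →w M' → (M · N) →w (M' · N)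

_→w*_ : ∀ {n} → Tm n → Tm n → Set
_→w*_ = Star _→w_

data _⇒_ {n : ℕ} : Tm n → Tm n → Set where
  p-fv  : ∀ x → fv x ⇒ fv x
  p-bv  : ∀ i → bv i ⇒ bv i
  p-app : ∀ {M M' N N'} → M ⇒ M' → N ⇒ N' → (M · N) ⇒ (M' · N')
  p-lam : ∀ {M M' : Tm (suc n)} → M ⇒ M' → ƛ M ⇒ ƛ M'
  p-β   : ∀ {M M' : Tm (suc n)} {N N'} → M ⇒ M' → N ⇒ N' → (ƛ M · N) ⇒ (M' [ N' ])

-- Parallel reduction that leaves the weak-head redex, if any, uncontracted.
data _⇒ᵢ_ {n : ℕ} : Tm n → Tm n → Set where
  i-fv  : ∀ x → fv x ⇒ᵢ fv x
  i-bv  : ∀ i → bv i ⇒ᵢ bv i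
  i-app : ∀ {M M' N N'} → M ⇒ᵢ M' → N ⇒ N' → (M · N) ⇒ᵢ (M' · N')
  i-lam : ∀ {M M' : Tm (suc n)} → M ⇒ M' → ƛ M ⇒ᵢ ƛ M'

-- Normal-order evaluation to a normal form, and of a neutral spine.
data _⇓_  {n : ℕ} : Tm n → Tm n → Set
data _⇓ₙ_ {n : ℕ} : Tm n → Tm n → Set

data _⇓_ {n} where
  ⇓lam : ∀ {M N : Tm (suc n)} → M ⇓ N → ƛ M ⇓ ƛ N
  ⇓h   : ∀ {M M' N} → M →w M' → M' ⇓ N → M ⇓ N
  ⇓ne  : ∀ {M N} → M ⇓ₙ N → M ⇓ N

data _⇓ₙ_ {n} where
  ne-fv  : ∀ x → fv x ⇓ₙ fv x
  ne-bv  : ∀ i → bv i ⇓ₙ bv i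
  ne-app : ∀ {M M' N N'} → M ⇓ₙ M' → N ⇓ N' → (M · N) ⇓ₙ (M' · N')

∷⁺ : ∀ {A : Set} {R : A → A → Set} {n} {x y : A} {σ σ' : Vector A n} →
     R x y → Pointwise R σ σ' → Pointwise R (x ∷ᵥ σ) (y ∷ᵥ σ')
∷⁺ r rs zero    = r
∷⁺ r rs (suc i) = rs i

⇒-refl : ∀ {n} (M : Tm n) → M ⇒ M
⇒-refl (fv x)  = p-fv x
⇒-refl (bv i)  = p-bv i
⇒-refl (M · N) = p-app (⇒-refl M) (⇒-refl N)
⇒-refl (ƛ M)   = p-lam (⇒-refl M)

→β⇒⇒ : ∀ {n} {M M' : Tm n} → M →β M' → M ⇒ M'
→β⇒⇒ (β {M} {N})        = p-β (⇒-refl M) (⇒-refl N)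
→β⇒⇒ (appL {N = N} s)   = p-app (→β⇒⇒ s) (⇒-refl N)
→β⇒⇒ (appR {M = M} s)   = p-app (⇒-refl M) (→β⇒⇒ s)
→β⇒⇒ (lam s)            = p-lam (→β⇒⇒ s)

⇒-ren : ∀ {n m} (r : Fin n → Fin m) {M M' : Tm n} → M ⇒ M' → ren r M ⇒ ren r M'
⇒-ren r (p-fv x)    = p-fv x
⇒-ren r (p-bv i)    = p-bv (r i)
⇒-ren r (p-app d e) = p-app (⇒-ren r d) (⇒-ren r e)
⇒-ren r (p-lam d)   = p-lam (⇒-ren (extR r) d)
⇒-ren r (p-β {M' = M'} {N' = N'} d e) =
  subst (_ ⇒_) (sym (ren-[] r M' N')) (p-β (⇒-ren (extR r) d) (⇒-ren r e))

⇒-exts : ∀ {n m} {σ σ' : Fin n → Tm m} → Pointwise _⇒_ σ σ' → Pointwise _⇒_ (exts σ) (exts σ')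
⇒-exts h zero    = p-bv zero
⇒-exts h (suc i) = ⇒-ren suc (h i)

⇒-sub : ∀ {n m} {σ σ' : Fin n → Tm m} {M M' : Tm n} →
        M ⇒ M' → Pointwise _⇒_ σ σ' → sub σ M ⇒ sub σ' M'
⇒-sub (p-fv x)    h = p-fv x
⇒-sub (p-bv i)    h = h i
⇒-sub (p-app d e) h = p-app (⇒-sub d h) (⇒-sub e h)
⇒-sub (p-lam d)   h = p-lam (⇒-sub d (⇒-exts h))
⇒-sub {σ' = σ'} (p-β {M' = M'} {N' = N'} d e) h =
  subst (_ ⇒_) (sym (sub-[] σ' M' N')) (p-β (⇒-sub d (⇒-exts h)) (⇒-sub e h))

⇒-[] : ∀ {n} {M M' : Tm (suc n)} {N N'} → M ⇒ M' → N ⇒ N' → (M [ N ]) ⇒ (M' [ N' ])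
⇒-[] d e = ⇒-sub d single⁺
  where
  single⁺ : Pointwise _⇒_ (single _) (single _)
  single⁺ zero    = e
  single⁺ (suc i) = p-bv i

WhFactor : ∀ {n} → Tm n → Tm n → Set
WhFactor M M' = ∃ λ L → M →w* L × L ⇒ᵢ M'

⇒-sub-whFactor : ∀ {n m} {σ σ' : Fin n → Tm m} {M M' : Tm n} → M ⇒ M' →
                 Pointwise _⇒_ σ σ' → Pointwise WhFactor σ σ' → WhFactor (sub σ M) (sub σ' M')
⇒-sub-whFactor (p-fv x)    h f = fv x , ε , i-fv x
⇒-sub-whFactor (p-bv i)    h f = f i
⇒-sub-whFactor (p-lam d)   h f = _ , ε , i-lam (⇒-sub d (⇒-exts h))
⇒-sub-whFactor {σ = σ} (p-app {N = N} d e) h f with ⇒-sub-whFactor d h f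
... | L , r , i = L · sub σ N , gmap (_· sub σ N) w-app r , i-app i (⇒-sub e h)
⇒-sub-whFactor {σ = σ} {σ'} (p-β {M} {M'} {N} {N'} d e) h f
  with ⇒-sub-whFactor d (∷⁺ {R = _⇒_} (⇒-sub e h) h) (∷⁺ {R = WhFactor} (⇒-sub-whFactor e h f) f)
... | L , r , i =
  L , subst ((ƛ _ · _) →w_) (exts-[] σ M (sub σ N)) w-β ◅ r ,
  subst (L ⇒ᵢ_) (sym (trans (sub-[] σ' M' N') (exts-[] σ' M' (sub σ' N')))) i

⇒-whFactor : ∀ {n} {M M' : Tm n} → M ⇒ M' → WhFactor M M'
⇒-whFactor {M = M} {M'} d with ⇒-sub-whFactor d p-bv (λ i → bv i , ε , i-bv i)
... | L , r , i = L , subst (_→w* L) (sub-id M) r , subst (L ⇒ᵢ_) (sub-id M') i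

⇒ᵢ-→w : ∀ {n} {L M M' : Tm n} → L ⇒ᵢ M → M →w M' → ∃ λ L' → L →w L' × L' ⇒ M'
⇒ᵢ-→w (i-app (i-lam d) e) w-β = _ , w-β , ⇒-[] d e
⇒ᵢ-→w (i-app i e) (w-app s) with ⇒ᵢ-→w i s
... | L' , s' , d' = _ , w-app s' , p-app d' e

→w*-⇓ : ∀ {n} {M L N : Tm n} → M →w* L → L ⇓ N → M ⇓ N
→w*-⇓ ε       D = D
→w*-⇓ (s ◅ r) D = ⇓h s (→w*-⇓ r D)

⇒-⇓   : ∀ {n} {M M' N : Tm n} → M ⇒ M' → M' ⇓ N → M ⇓ N
⇒ᵢ-⇓  : ∀ {n} {L M N : Tm n} → L ⇒ᵢ M → M ⇓ N → L ⇓ N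
⇒ᵢ-⇓ₙ : ∀ {n} {L M N : Tm n} → L ⇒ᵢ M → M ⇓ₙ N → L ⇓ₙ N

⇒-⇓ d D with ⇒-whFactor d
... | L , r , i = →w*-⇓ r (⇒ᵢ-⇓ i D)

⇒ᵢ-⇓ (i-lam d) (⇓lam D) = ⇓lam (⇒-⇓ d D)
⇒ᵢ-⇓ i (⇓h s D) with ⇒ᵢ-→w i s
... | L' , s' , d' = ⇓h s' (⇒-⇓ d' D)
⇒ᵢ-⇓ i (⇓ne E) = ⇓ne (⇒ᵢ-⇓ₙ i E)

⇒ᵢ-⇓ₙ (i-fv x)    (ne-fv .x)   = ne-fv x
⇒ᵢ-⇓ₙ (i-bv i)    (ne-bv .i)   = ne-bv i
⇒ᵢ-⇓ₙ (i-app i e) (ne-app E D) = ne-app (⇒ᵢ-⇓ₙ i E) (⇒-⇓ e D)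

Nf-⇓ : ∀ {n} {M : Tm n} → Nf M → M ⇓ M
Ne-⇓ₙ : ∀ {n} {M : Tm n} → Ne M → M ⇓ₙ M

Nf-⇓ (nf-ne h)  = ⇓ne (Ne-⇓ₙ h)
Nf-⇓ (nf-lam h) = ⇓lam (Nf-⇓ h)

Ne-⇓ₙ (ne-fv x)     = ne-fv x
Ne-⇓ₙ (ne-bv i)     = ne-bv i
Ne-⇓ₙ (ne-app h h') = ne-app (Ne-⇓ₙ h) (Nf-⇓ h')

→β*-Nf⇒⇓ : ∀ {n} {M N : Tm n} → Star _→β_ M N → Nf N → M ⇓ N
→β*-Nf⇒⇓ ε       h = Nf-⇓ h
→β*-Nf⇒⇓ (s ◅ r) h = ⇒-⇓ (→β⇒⇒ s) (→β*-Nf⇒⇓ r h)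

-- Completeness

maxName : ∀ {n} → Tm n → ℕ
maxName (fv x)  = x
maxName (bv i)  = 0
maxName (M · N) = maxName M ⊔ maxName N
maxName (ƛ M)   = maxName M

∈fv⇒≤maxName : ∀ {n x} {M : Tm n} → x ∈fv M → x ≤ maxName M
∈fv⇒≤maxName here = ≤-refl
∈fv⇒≤maxName {M = M · N} (inL p) = ≤-trans (∈fv⇒≤maxName p) (m≤m⊔n (maxName M) (maxName N))
∈fv⇒≤maxName {M = M · N} (inR p) = ≤-trans (∈fv⇒≤maxName p) (m≤n⊔m (maxName M) (maxName N))
∈fv⇒≤maxName (inƛ p) = ∈fv⇒≤maxName p

maxNameᵛ : ∀ {n} → Vector Name n → ℕ
maxNameᵛ {zero}  σ = 0
maxNameᵛ {suc n} σ = σ zero ⊔ maxNameᵛ (σ ∘ suc)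

≤maxNameᵛ : ∀ {n} (σ : Vector Name n) (i : Fin n) → σ i ≤ maxNameᵛ σ
≤maxNameᵛ σ zero    = m≤m⊔n (σ zero) (maxNameᵛ (σ ∘ suc))
≤maxNameᵛ σ (suc i) = ≤-trans (≤maxNameᵛ (σ ∘ suc) i) (m≤n⊔m (σ zero) (maxNameᵛ (σ ∘ suc)))

-- The bound variables of a term under evaluation are instantiated by the
-- names the machine chose for the binders it went through.
instantiate : ∀ {n} → Vector Name n → Tm n → Λ
instantiate σ = sub (fv ∘ σ)

⇝-InΛrb : ∀ {S S'} → S ⇝ S' → InΛrb S'
⇝-InΛrb (r1 C M)                 = rb-atom _
⇝-InΛrb (r2 C M x b _)           = rb-bul _ (InΛ•-[] b (InΛ•-• (fv x)))
⇝-InΛrb (r3 C M N₀ Ns n₀ ns)     = rb-app C (rb-bul _ n₀) ns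
⇝-InΛrb (r4 C M N₀ Ns b n₀ ns)   = rb-bul C (InΛ•-apps Ns (InΛ•-[] b n₀) ns)
⇝-InΛrb (r5 C Ns _ rb' _ ns)     = rb-app C rb' ns

⇝*-apps : ∀ C {Ns} → All InΛ• Ns → ∀ {S S'} → InΛrb S → S ⇝* S' →
          ⟨ C , apps S Ns ⟩ ⇝* ⟨ C , apps S' Ns ⟩
⇝*-apps C ns rb ε       = ε
⇝*-apps C ns rb (s ◅ r) = r5 C _ rb (⇝-InΛrb s) s ns ◅ ⇝*-apps C ns (⇝-InΛrb s) r

→w-machine : ∀ {n} {M M' : Tm n} (σ : Vector Name n) (C : Ctx) {Ks} → All InΛ• Ks → M →w M' →
             ⟨ C , apps (instantiate σ M •) Ks ⟩ ⇝ ⟨ C , apps (instantiate σ M' •) Ks ⟩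
→w-machine σ C {Ks} ks (w-β {M} {N}) =
  subst (λ E → ⟨ C , apps (ƛᵉ (B •) ∙ (instantiate σ N •)) Ks ⟩ ⇝ ⟨ C , apps E Ks ⟩) reduct
    (r4 C (B •) (instantiate σ N •) Ks (InΛ•-• (ƛ B)) (InΛ•-• (instantiate σ N)) ks)
  where
  B = sub (exts (fv ∘ σ)) M
  reduct : (B •) [ instantiate σ N • ]ᵉ ≡ instantiate σ (M [ N ]) •
  reduct = trans (•-[] B (instantiate σ N)) (cong _• (sym (sub-[] (fv ∘ σ) M N)))
→w-machine σ C ks (w-app {N = N} s) = →w-machine σ C (InΛ•-• (instantiate σ N) ∷ ks) s

⇓-machine  : ∀ {n} {M N : Tm n} (σ : Vector Name n) (C : Ctx) → M ⇓ N →
             ⟨ C , instantiate σ M • ⟩ ⇝* ⌜ plug C (instantiate σ N) ⌝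
⇓ₙ-machine : ∀ {n} {M N : Tm n} (σ : Vector Name n) (C : Ctx) {Ks} → All InΛ• Ks → M ⇓ₙ N →
             ⟨ C , apps (instantiate σ M •) Ks ⟩ ⇝* ⟨ C , apps ⌜ instantiate σ N ⌝ Ks ⟩

⇓-machine σ C (⇓h s D) = →w-machine σ C [] s ◅ ⇓-machine σ C D
⇓-machine σ C (⇓ne E)  = ⇓ₙ-machine σ C [] E ◅◅ return (r1 C _)
⇓-machine σ C (⇓lam {M} {N} D) =
  r2 C (B •) x (InΛ•-• (ƛ B)) (x∉B ∘ ∈atoms•⇒∈fv B) ◅
  subst₂ _⇝*_ (cong ⟨ C' ,_⟩ (sym opened)) (cong ⌜_⌝ closed) (⇓-machine (x ∷ᵥ σ) C' D)
  where
  B  = sub (exts (fv ∘ σ)) M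
  k  = maxName B ⊔ maxName N ⊔ maxNameᵛ σ
  x  = suc k
  C' = plugᶜ C (ƛ[ x ] □)
  fresh : ∀ {y} → y ≤ k → y ≢ x
  fresh y≤k = <⇒≢ (s≤s y≤k)
  x∉B : ¬ x ∈fv B
  x∉B p = fresh (≤-trans (∈fv⇒≤maxName p) (≤-trans (m≤m⊔n _ _) (m≤m⊔n _ _))) refl
  x∉N : ¬ x ∈fv N
  x∉N p = fresh (≤-trans (∈fv⇒≤maxName p) (≤-trans (m≤n⊔m (maxName B) _) (m≤m⊔n _ _))) refl
  σ≢x : ∀ i → σ i ≢ x
  σ≢x i = fresh (≤-trans (≤maxNameᵛ σ i) (m≤n⊔m _ _))
  opened : (B •) [ ⌜ fv x ⌝ ]ᵉ ≡ instantiate (x ∷ᵥ σ) M •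
  opened = trans (•-[] B (fv x))
                 (cong _• (trans (exts-[] (fv ∘ σ) M (fv x)) (sub-cong (∷-cong refl (λ _ → refl)) M)))
  closed : plug C' (instantiate (x ∷ᵥ σ) N) ≡ plug C (instantiate σ (ƛ N))
  closed = trans (plug-plugᶜ C (ƛ[ x ] □) _) (cong (plug C ∘ ƛ) (close-∷ x σ N x∉N σ≢x))

⇓ₙ-machine σ C ks (ne-fv x) = ε
⇓ₙ-machine σ C ks (ne-bv i) = ε
⇓ₙ-machine σ C {Ks} ks (ne-app {M' = M'} {N} E D) =
  ⇓ₙ-machine σ C (InΛ•-• (instantiate σ N) ∷ ks) E ◅◅
  r3 C (instantiate σ M') (instantiate σ N •) Ks (InΛ•-• (instantiate σ N)) ks ◅
  ⇝*-apps C ks (rb-bul _ (InΛ•-• (instantiate σ N))) (⇓-machine σ (instantiate σ M' ·ᵣ □) D)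

completeness : ∀ {M N} → M →β* N → NF N → ⟨ □ , M • ⟩ ⇝* ⌜ N ⌝
completeness {M} {N} r nf =
  subst₂ (λ A B → ⟨ □ , A • ⟩ ⇝* ⌜ B ⌝) (sub-empty M) (sub-empty N)
    (⇓-machine (λ ()) □ (→β*-Nf⇒⇓ r (NF⇒Nf nf)))

proposition7 : (M N : Λ) → (⟨ □ , M • ⟩ ⇝* ⌜ N ⌝) ⇔ ((M →β* N) × NF N)
proposition7 M N = mk⇔ soundness (uncurry completeness)
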